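{- Let $K=-t+4tx^2F+4x^3F^3$. Then $K^3Q\in\mathcal{I}$ and $K^3\tilde Q\in\mathcal{I}$.
   Context: Let $\mathcal{A}=\mathbb{Q}[t,x,F,F_t,F_x,F_{tt},F_{tx},F_{xx}]$ be the polynomial algebra in eight independent variables. Let $\partial_t,\partial_x$ be the derivations (from the subalgebra generated by $t,x,F,F_t,F_x$ into $\mathcal A$) with $\partial_t t=1,\partial_t x=0,\partial_tF=F_t,\partial_tF_t=F_{tt},\partial_tF_x=F_{tx}$ and $\partial_x t=0,\partial_xx=1,\partial_xF=F_x,\partial_xF_t=F_{tx},\partial_xF_x=F_{xx}$. Let $P=t(1+tx)-tF+2tx^2F^2+x^3F^4$, and let $\mathcal I$ be the ideal of $\mathcal A$ generated by $P,\ P_t=\partial_tP,\ P_x=\partial_xP,\ P_{tt}=\partial_t\partial_tP,\ P_{tx}=\partial_x\partial_tP,\ P_{xx}=\partial_x\partial_xP$. Define $Q=4tx(2F-4tF_t+4xF_x-3t^2F_{tt}-2txF_{tx}+x^2F_{xx})-(3tF_t-xF_x+9t^2F_{tt}+6txF_{tx}+x^2F_{xx})$ and $\tilde Q=4x(2xF_x-3t^2F_{tt}+2txF_{tx}+x^2F_{xx})-t(3tF_t+3xF_x+9t^2F_{tt}-6txF_{tx}+x^2F_{xx})$. -}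

module Defs where

open import Data.Nat using (ℕ; zero; suc)
open import Data.Fin using (Fin; zero; suc)
open import Data.Integer using (+_)
open import Data.Rational using (ℚ; _/_; 0ℚ; 1ℚ)
import Data.Rational as Q
open import Data.Product using (Σ; ∃; _,_)
open import Relation.Binary.PropositionalEquality using (_≡_)

-- Polynomial expressions in the eight variables of
-- 𝒜 = ℚ[t,x,F,F_t,F_x,F_tt,F_tx,F_xx] with rational constants.
-- Variable order: 0=t 1=x 2=F 3=F_t 4=F_x 5=F_tt 6=F_tx 7=F_xx.
infixl 6 _⊕_ _⊖_
infixl 7 _⊗_
infixr 8 _^^_

data Expr : Set where
  con  : ℚ → Expr
  var  : Fin 8 → Expr
  _⊕_  : Expr → Expr → Expr
  _⊗_  : Expr → Expr → Expr
  neg  : Expr → Expr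

_⊖_ : Expr → Expr → Expr
a ⊖ b = a ⊕ neg b

# : ℕ → Expr
# n = con (+ n / 1)

_^^_ : Expr → ℕ → Expr
a ^^ zero = # 1
a ^^ suc n = a ⊗ (a ^^ n)

vt vx vF vFt vFx vFtt vFtx vFxx : Expr
vt   = var zero
vx   = var (suc zero)
vF   = var (suc (suc zero))
vFt  = var (suc (suc (suc zero)))
vFx  = var (suc (suc (suc (suc zero))))
vFtt = var (suc (suc (suc (suc (suc zero)))))
vFtx = var (suc (suc (suc (suc (suc (suc zero))))))
vFxx = var (suc (suc (suc (suc (suc (suc (suc zero)))))))

⟦_⟧ : Expr → (Fin 8 → ℚ) → ℚ
⟦ con q ⟧ ρ = q
⟦ var i ⟧ ρ = ρ i
⟦ a ⊕ b ⟧ ρ = ⟦ a ⟧ ρ Q.+ ⟦ b ⟧ ρ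
⟦ a ⊗ b ⟧ ρ = ⟦ a ⟧ ρ Q.* ⟦ b ⟧ ρ
⟦ neg a ⟧ ρ = Q.- (⟦ a ⟧ ρ)

-- Equality in 𝒜: since ℚ is infinite, two polynomials are equal in
-- 𝒜 iff they agree at every point of ℚ^8.
infix 4 _≈_
_≈_ : Expr → Expr → Set
a ≈ b = ∀ (ρ : Fin 8 → ℚ) → ⟦ a ⟧ ρ ≡ ⟦ b ⟧ ρ

-- They are only specified on
-- t,x,F,F_t,F_x; on F_tt,F_tx,F_xx we put 0 (never used below, since all
-- derivatives taken are of elements of the subalgebra ℚ[t,x,F,F_t,F_x]).
∂tVar : Fin 8 → Expr
∂tVar zero = # 1
∂tVar (suc zero) = # 0
∂tVar (suc (suc zero)) = vFt
∂tVar (suc (suc (suc zero))) = vFtt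
∂tVar (suc (suc (suc (suc zero)))) = vFtx
∂tVar (suc (suc (suc (suc (suc _))))) = # 0

∂xVar : Fin 8 → Expr
∂xVar zero = # 0
∂xVar (suc zero) = # 1
∂xVar (suc (suc zero)) = vFx
∂xVar (suc (suc (suc zero))) = vFtx
∂xVar (suc (suc (suc (suc zero)))) = vFxx
∂xVar (suc (suc (suc (suc (suc _))))) = # 0

derive : (Fin 8 → Expr) → Expr → Expr
derive d (con q) = # 0
derive d (var i) = d i
derive d (a ⊕ b) = derive d a ⊕ derive d b
derive d (a ⊗ b) = derive d a ⊗ b ⊕ a ⊗ derive d b
derive d (neg a) = neg (derive d a)

∂t ∂x : Expr → Expr
∂t = derive ∂tVar
∂x = derive ∂xVar

P : Expr
P = vt ⊗ (# 1 ⊕ vt ⊗ vx) ⊖ vt ⊗ vF ⊕ # 2 ⊗ vt ⊗ vx ^^ 2 ⊗ vF ^^ 2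
    ⊕ vx ^^ 3 ⊗ vF ^^ 4

Pt Px Ptt Ptx Pxx : Expr
Pt  = ∂t P
Px  = ∂x P
Ptt = ∂t (∂t P)
Ptx = ∂x (∂t P)
Pxx = ∂x (∂x P)

InI : Expr → Set
InI e = Σ Expr λ c₁ → Σ Expr λ c₂ → Σ Expr λ c₃ →
        Σ Expr λ c₄ → Σ Expr λ c₅ → Σ Expr λ c₆ →
        e ≈ c₁ ⊗ P ⊕ c₂ ⊗ Pt ⊕ c₃ ⊗ Px ⊕ c₄ ⊗ Ptt ⊕ c₅ ⊗ Ptx ⊕ c₆ ⊗ Pxx

Q : Expr
Q = # 4 ⊗ vt ⊗ vx ⊗
      (# 2 ⊗ vF ⊖ # 4 ⊗ vt ⊗ vFt ⊕ # 4 ⊗ vx ⊗ vFx ⊖ # 3 ⊗ vt ^^ 2 ⊗ vFtt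
       ⊖ # 2 ⊗ vt ⊗ vx ⊗ vFtx ⊕ vx ^^ 2 ⊗ vFxx)
    ⊖ (# 3 ⊗ vt ⊗ vFt ⊖ vx ⊗ vFx ⊕ # 9 ⊗ vt ^^ 2 ⊗ vFtt
       ⊕ # 6 ⊗ vt ⊗ vx ⊗ vFtx ⊕ vx ^^ 2 ⊗ vFxx)

Q̃ : Expr
Q̃ = # 4 ⊗ vx ⊗
      (# 2 ⊗ vx ⊗ vFx ⊖ # 3 ⊗ vt ^^ 2 ⊗ vFtt ⊕ # 2 ⊗ vt ⊗ vx ⊗ vFtx
       ⊕ vx ^^ 2 ⊗ vFxx)
    ⊖ vt ⊗ (# 3 ⊗ vt ⊗ vFt ⊕ # 3 ⊗ vx ⊗ vFx ⊕ # 9 ⊗ vt ^^ 2 ⊗ vFtt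
       ⊖ # 6 ⊗ vt ⊗ vx ⊗ vFtx ⊕ vx ^^ 2 ⊗ vFxx)

K : Expr
K = neg vt ⊕ # 4 ⊗ vt ⊗ vx ^^ 2 ⊗ vF ⊕ # 4 ⊗ vx ^^ 3 ⊗ vF ^^ 3

-- K is the F-derivative of P. Modulo 𝓘 the chain rule turns P_t and P_x into
-- K F_t ≡ -Pᵗ and K F_x ≡ -Pˣ, and the second derivatives of P into
-- K³ F_ij ≡ -N_ij, the numerators of implicit differentiation. Substituting these
-- into K³Q and K³Q̃, which are linear in F and its derivatives, leaves polynomials
-- in t, x, F alone, and both turn out to be multiples of P.

module Submission where

open import Defs
open import Data.Bool using (T)
open import Data.Maybe using (just; is-just)
open import Data.Product using (_×_; _,_)
open import Data.Unit using (tt)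
open import Data.Rational using (ℚ; 0ℚ; 1ℚ)
import Data.Rational as ℚ
open import Data.Rational.Solver using (module +-*-Solver)
open import Data.Vec using (Vec; tabulate)
open import Data.Vec.Properties using (lookup∘tabulate)
open import Relation.Binary.Bundles using (Setoid)
import Relation.Binary.Reasoning.Setoid as SetoidReasoning
open import Relation.Binary.PropositionalEquality
  using (_≡_; refl; sym; trans; cong; cong₂; module ≡-Reasoning)

open +-*-Solver
  using ( Polynomial; op; [+]; [*]; normalise; _≟N_; ⟦_⟧N; ⟦_⟧N-cong; correct
        ; solve; _:=_; _:+_; _:*_; :-_; _:-_; con)
  renaming (var to var′; ⟦_⟧ to ⟦_⟧′)

toPolynomial : Expr → Polynomial 8
toPolynomial (con q) = con q
toPolynomial (var i) = var′ i
toPolynomial (a ⊕ b) = op [+] (toPolynomial a) (toPolynomial b)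
toPolynomial (a ⊗ b) = op [*] (toPolynomial a) (toPolynomial b)
toPolynomial (neg a) = :- toPolynomial a

⟦toPolynomial⟧ : ∀ e ρ → ⟦ toPolynomial e ⟧′ (tabulate ρ) ≡ ⟦ e ⟧ ρ
⟦toPolynomial⟧ (con q) ρ = refl
⟦toPolynomial⟧ (var i) ρ = lookup∘tabulate ρ i
⟦toPolynomial⟧ (a ⊕ b) ρ = cong₂ ℚ._+_ (⟦toPolynomial⟧ a ρ) (⟦toPolynomial⟧ b ρ)
⟦toPolynomial⟧ (a ⊗ b) ρ = cong₂ ℚ._*_ (⟦toPolynomial⟧ a ρ) (⟦toPolynomial⟧ b ρ)
⟦toPolynomial⟧ (neg a) ρ = cong ℚ.-_ (⟦toPolynomial⟧ a ρ)

SameNormalForm : Expr → Expr → Set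
SameNormalForm a b = T (is-just (normalise (toPolynomial a) ≟N normalise (toPolynomial b)))

≈-byNormalisation : ∀ a b → SameNormalForm a b → a ≈ b
≈-byNormalisation a b same ρ
  with normalise (toPolynomial a) ≟N normalise (toPolynomial b)
... | just eq = begin
  ⟦ a ⟧ ρ                             ≡⟨ ⟦toPolynomial⟧ a ρ ⟨
  ⟦ toPolynomial a ⟧′ ρ′              ≡⟨ correct (toPolynomial a) ρ′ ⟨
  ⟦ normalise (toPolynomial a) ⟧N ρ′  ≡⟨ ⟦ eq ⟧N-cong ρ′ ⟩
  ⟦ normalise (toPolynomial b) ⟧N ρ′  ≡⟨ correct (toPolynomial b) ρ′ ⟩
  ⟦ toPolynomial b ⟧′ ρ′              ≡⟨ ⟦toPolynomial⟧ b ρ ⟩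
  ⟦ b ⟧ ρ                             ∎
  where
  ρ′ : Vec ℚ 8
  ρ′ = tabulate ρ
  open ≡-Reasoning

-- InI e unfolds to a Σ-type, from which Agda cannot recover e; wrapping
-- it in a record makes e inferable from the type.
infix 4 _∈𝓘
record _∈𝓘 (e : Expr) : Set where
  constructor member
  field certificate : InI e

open _∈𝓘

∈𝓘-resp-≈ : ∀ {a b} → a ≈ b → a ∈𝓘 → b ∈𝓘
∈𝓘-resp-≈ a≈b (member (c₁ , c₂ , c₃ , c₄ , c₅ , c₆ , a≈)) =
  member (c₁ , c₂ , c₃ , c₄ , c₅ , c₆ , λ ρ → trans (sym (a≈b ρ)) (a≈ ρ))

∈𝓘-linear : ∀ u v {a b} → a ∈𝓘 → b ∈𝓘 → u ⊗ a ⊕ v ⊗ b ∈𝓘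
∈𝓘-linear u v (member (c₁ , c₂ , c₃ , c₄ , c₅ , c₆ , a≈))
              (member (d₁ , d₂ , d₃ , d₄ , d₅ , d₆ , b≈)) = member
  ( u ⊗ c₁ ⊕ v ⊗ d₁ , u ⊗ c₂ ⊕ v ⊗ d₂ , u ⊗ c₃ ⊕ v ⊗ d₃
  , u ⊗ c₄ ⊕ v ⊗ d₄ , u ⊗ c₅ ⊕ v ⊗ d₅ , u ⊗ c₆ ⊕ v ⊗ d₆ , λ ρ →
    let ⟦_⟧ρ = λ e → ⟦ e ⟧ ρ in
    trans (cong₂ (λ x y → ⟦ u ⟧ρ ℚ.* x ℚ.+ ⟦ v ⟧ρ ℚ.* y) (a≈ ρ) (b≈ ρ))
      (solve 20 (λ u v c₁ c₂ c₃ c₄ c₅ c₆ d₁ d₂ d₃ d₄ d₅ d₆ g₁ g₂ g₃ g₄ g₅ g₆ →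
         u :* (c₁ :* g₁ :+ c₂ :* g₂ :+ c₃ :* g₃ :+ c₄ :* g₄ :+ c₅ :* g₅ :+ c₆ :* g₆)
           :+ v :* (d₁ :* g₁ :+ d₂ :* g₂ :+ d₃ :* g₃ :+ d₄ :* g₄ :+ d₅ :* g₅ :+ d₆ :* g₆)
         := (u :* c₁ :+ v :* d₁) :* g₁ :+ (u :* c₂ :+ v :* d₂) :* g₂
            :+ (u :* c₃ :+ v :* d₃) :* g₃ :+ (u :* c₄ :+ v :* d₄) :* g₄
            :+ (u :* c₅ :+ v :* d₅) :* g₅ :+ (u :* c₆ :+ v :* d₆) :* g₆) refl
        ⟦ u ⟧ρ ⟦ v ⟧ρ ⟦ c₁ ⟧ρ ⟦ c₂ ⟧ρ ⟦ c₃ ⟧ρ ⟦ c₄ ⟧ρ ⟦ c₅ ⟧ρ ⟦ c₆ ⟧ρ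
        ⟦ d₁ ⟧ρ ⟦ d₂ ⟧ρ ⟦ d₃ ⟧ρ ⟦ d₄ ⟧ρ ⟦ d₅ ⟧ρ ⟦ d₆ ⟧ρ
        ⟦ P ⟧ρ ⟦ Pt ⟧ρ ⟦ Px ⟧ρ ⟦ Ptt ⟧ρ ⟦ Ptx ⟧ρ ⟦ Pxx ⟧ρ))

∈𝓘-byCertificate : ∀ {e} c₁ c₂ c₃ c₄ c₅ c₆ →
  SameNormalForm e (c₁ ⊗ P ⊕ c₂ ⊗ Pt ⊕ c₃ ⊗ Px ⊕ c₄ ⊗ Ptt ⊕ c₅ ⊗ Ptx ⊕ c₆ ⊗ Pxx) →
  e ∈𝓘
∈𝓘-byCertificate {e} c₁ c₂ c₃ c₄ c₅ c₆ same =
  member (c₁ , c₂ , c₃ , c₄ , c₅ , c₆ , ≈-byNormalisation e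
    (c₁ ⊗ P ⊕ c₂ ⊗ Pt ⊕ c₃ ⊗ Px ⊕ c₄ ⊗ Ptt ⊕ c₅ ⊗ Ptx ⊕ c₆ ⊗ Pxx) same)

P∈𝓘 : P ∈𝓘
P∈𝓘 = ∈𝓘-byCertificate (# 1) (# 0) (# 0) (# 0) (# 0) (# 0) tt

Pt∈𝓘 : Pt ∈𝓘
Pt∈𝓘 = ∈𝓘-byCertificate (# 0) (# 1) (# 0) (# 0) (# 0) (# 0) tt

Px∈𝓘 : Px ∈𝓘
Px∈𝓘 = ∈𝓘-byCertificate (# 0) (# 0) (# 1) (# 0) (# 0) (# 0) tt

Ptt∈𝓘 : Ptt ∈𝓘
Ptt∈𝓘 = ∈𝓘-byCertificate (# 0) (# 0) (# 0) (# 1) (# 0) (# 0) tt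

Ptx∈𝓘 : Ptx ∈𝓘
Ptx∈𝓘 = ∈𝓘-byCertificate (# 0) (# 0) (# 0) (# 0) (# 1) (# 0) tt

Pxx∈𝓘 : Pxx ∈𝓘
Pxx∈𝓘 = ∈𝓘-byCertificate (# 0) (# 0) (# 0) (# 0) (# 0) (# 1) tt

infix 4 _≋_
_≋_ : Expr → Expr → Set
a ≋ b = a ⊖ b ∈𝓘

∈𝓘⇒≋0 : ∀ {a} → a ∈𝓘 → a ≋ # 0
∈𝓘⇒≋0 {a} = ∈𝓘-resp-≈ λ ρ → solve 1 (λ x → x := x :- con 0ℚ) refl (⟦ a ⟧ ρ)

≋0⇒∈𝓘 : ∀ {a} → a ≋ # 0 → a ∈𝓘
≋0⇒∈𝓘 {a} = ∈𝓘-resp-≈ λ ρ → solve 1 (λ x → x :- con 0ℚ := x) refl (⟦ a ⟧ ρ)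

≈⇒≋ : ∀ {a b} → a ≈ b → a ≋ b
≈⇒≋ {a} {b} a≈b = ∈𝓘-resp-≈ zero≈a-b (∈𝓘-linear (# 0) (# 0) P∈𝓘 P∈𝓘)
  where
  zero≈a-b : # 0 ⊗ P ⊕ # 0 ⊗ P ≈ a ⊖ b
  zero≈a-b ρ = trans
    (solve 2 (λ x p → con 0ℚ :* p :+ con 0ℚ :* p := x :- x) refl (⟦ b ⟧ ρ) (⟦ P ⟧ ρ))
    (cong (ℚ._- ⟦ b ⟧ ρ) (sym (a≈b ρ)))

≋-byNormalisation : ∀ {a b} → SameNormalForm a b → a ≋ b
≋-byNormalisation {a} {b} same = ≈⇒≋ (≈-byNormalisation a b same)

≋-refl : ∀ {a} → a ≋ a
≋-refl = ≈⇒≋ λ _ → refl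

≋-sym : ∀ {a b} → a ≋ b → b ≋ a
≋-sym {a} {b} a≋b = ∈𝓘-resp-≈
  (λ ρ → solve 2 (λ x y → con (ℚ.- 1ℚ) :* (x :- y) :+ con 0ℚ :* (x :- y) := y :- x) refl
           (⟦ a ⟧ ρ) (⟦ b ⟧ ρ))
  (∈𝓘-linear (neg (# 1)) (# 0) a≋b a≋b)

≋-trans : ∀ {a b c} → a ≋ b → b ≋ c → a ≋ c
≋-trans {a} {b} {c} a≋b b≋c = ∈𝓘-resp-≈
  (λ ρ → solve 3 (λ x y z → con 1ℚ :* (x :- y) :+ con 1ℚ :* (y :- z) := x :- z) refl
           (⟦ a ⟧ ρ) (⟦ b ⟧ ρ) (⟦ c ⟧ ρ))
  (∈𝓘-linear (# 1) (# 1) a≋b b≋c)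

⊕-cong : ∀ {a a′ b b′} → a ≋ a′ → b ≋ b′ → a ⊕ b ≋ a′ ⊕ b′
⊕-cong {a} {a′} {b} {b′} a≋a′ b≋b′ = ∈𝓘-resp-≈
  (λ ρ → solve 4 (λ x x′ y y′ → con 1ℚ :* (x :- x′) :+ con 1ℚ :* (y :- y′)
                                 := x :+ y :- (x′ :+ y′)) refl
           (⟦ a ⟧ ρ) (⟦ a′ ⟧ ρ) (⟦ b ⟧ ρ) (⟦ b′ ⟧ ρ))
  (∈𝓘-linear (# 1) (# 1) a≋a′ b≋b′)

⊗-cong : ∀ {a a′ b b′} → a ≋ a′ → b ≋ b′ → a ⊗ b ≋ a′ ⊗ b′
⊗-cong {a} {a′} {b} {b′} a≋a′ b≋b′ = ∈𝓘-resp-≈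
  (λ ρ → solve 4 (λ x x′ y y′ → y :* (x :- x′) :+ x′ :* (y :- y′) := x :* y :- x′ :* y′)
           refl (⟦ a ⟧ ρ) (⟦ a′ ⟧ ρ) (⟦ b ⟧ ρ) (⟦ b′ ⟧ ρ))
  (∈𝓘-linear b a′ a≋a′ b≋b′)

neg-cong : ∀ {a a′} → a ≋ a′ → neg a ≋ neg a′
neg-cong {a} {a′} a≋a′ = ∈𝓘-resp-≈
  (λ ρ → solve 2 (λ x x′ → con (ℚ.- 1ℚ) :* (x :- x′) :+ con 0ℚ :* (x :- x′)
                           := :- x :- :- x′) refl
           (⟦ a ⟧ ρ) (⟦ a′ ⟧ ρ))
  (∈𝓘-linear (neg (# 1)) (# 0) a≋a′ a≋a′)

≋-setoid : Setoid _ _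
≋-setoid = record
  { Carrier = Expr ; _≈_ = _≋_
  ; isEquivalence = record { refl = ≋-refl ; sym = ≋-sym ; trans = ≋-trans } }

implicitFirstDerivative : ∀ {κ f a p} → p ≋ a ⊕ κ ⊗ f → p ≋ # 0 → κ ⊗ f ≋ neg a
implicitFirstDerivative {κ} {f} {a} {p} p≋ p≋0 = begin
  κ ⊗ f              ≈⟨ ≈⇒≋ (λ ρ → solve 3 (λ k f a → k :* f := a :+ k :* f :+ :- a) refl
                                  (⟦ κ ⟧ ρ) (⟦ f ⟧ ρ) (⟦ a ⟧ ρ)) ⟩
  a ⊕ κ ⊗ f ⊖ a      ≈⟨ ⊕-cong (≋-trans (≋-sym p≋) p≋0) ≋-refl ⟩
  # 0 ⊖ a            ≈⟨ ≈⇒≋ (λ ρ → solve 1 (λ a → con 0ℚ :- a := :- a) refl (⟦ a ⟧ ρ)) ⟩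
  neg a              ∎
  where open SetoidReasoning ≋-setoid

implicitSecondDerivative : ∀ {κ κᶠ κᵢ κⱼ fᵢ fⱼ fᵢⱼ aᵢ aⱼ aᵢⱼ} →
  κ ⊗ fᵢ ≋ neg aᵢ → κ ⊗ fⱼ ≋ neg aⱼ →
  κ ⊗ fᵢⱼ ⊕ aᵢⱼ ⊕ κᵢ ⊗ fⱼ ⊕ κⱼ ⊗ fᵢ ⊕ κᶠ ⊗ fᵢ ⊗ fⱼ ≋ # 0 →
  κ ^^ 3 ⊗ fᵢⱼ ≋ neg (κ ^^ 2 ⊗ aᵢⱼ ⊖ κ ⊗ (κᵢ ⊗ aⱼ ⊕ κⱼ ⊗ aᵢ) ⊕ κᶠ ⊗ aᵢ ⊗ aⱼ)
implicitSecondDerivative {κ} {κᶠ} {κᵢ} {κⱼ} {fᵢ} {fⱼ} {fᵢⱼ} {aᵢ} {aⱼ} {aᵢⱼ}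
                         κfᵢ≋ κfⱼ≋ fᵢⱼ-eq = begin
  κ ^^ 3 ⊗ fᵢⱼ
    ≈⟨ ≈⇒≋ (λ ρ → solve 8 (λ k kᶠ kᵢ kⱼ fᵢ fⱼ fᵢⱼ aᵢⱼ →
          k :* (k :* (k :* con 1ℚ)) :* fᵢⱼ
          := k :* (k :* con 1ℚ) :* (k :* fᵢⱼ :+ aᵢⱼ :+ kᵢ :* fⱼ :+ kⱼ :* fᵢ :+ kᶠ :* fᵢ :* fⱼ)
             :- (k :* (k :* con 1ℚ) :* aᵢⱼ :+ k :* kᵢ :* (k :* fⱼ) :+ k :* kⱼ :* (k :* fᵢ)
                 :+ kᶠ :* (k :* fᵢ) :* (k :* fⱼ))) refl
        (⟦ κ ⟧ ρ) (⟦ κᶠ ⟧ ρ) (⟦ κᵢ ⟧ ρ) (⟦ κⱼ ⟧ ρ) (⟦ fᵢ ⟧ ρ) (⟦ fⱼ ⟧ ρ) (⟦ fᵢⱼ ⟧ ρ) (⟦ aᵢⱼ ⟧ ρ)) ⟩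
  κ ^^ 2 ⊗ (κ ⊗ fᵢⱼ ⊕ aᵢⱼ ⊕ κᵢ ⊗ fⱼ ⊕ κⱼ ⊗ fᵢ ⊕ κᶠ ⊗ fᵢ ⊗ fⱼ)
    ⊖ (κ ^^ 2 ⊗ aᵢⱼ ⊕ κ ⊗ κᵢ ⊗ (κ ⊗ fⱼ) ⊕ κ ⊗ κⱼ ⊗ (κ ⊗ fᵢ) ⊕ κᶠ ⊗ (κ ⊗ fᵢ) ⊗ (κ ⊗ fⱼ))
    ≈⟨ ⊕-cong (⊗-cong ≋-refl fᵢⱼ-eq)
         (neg-cong (⊕-cong (⊕-cong (⊕-cong ≋-refl (⊗-cong ≋-refl κfⱼ≋)) (⊗-cong ≋-refl κfᵢ≋))
                           (⊗-cong (⊗-cong ≋-refl κfᵢ≋) κfⱼ≋))) ⟩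
  κ ^^ 2 ⊗ # 0 ⊖ (κ ^^ 2 ⊗ aᵢⱼ ⊕ κ ⊗ κᵢ ⊗ neg aⱼ ⊕ κ ⊗ κⱼ ⊗ neg aᵢ ⊕ κᶠ ⊗ neg aᵢ ⊗ neg aⱼ)
    ≈⟨ ≈⇒≋ (λ ρ → solve 7 (λ k kᶠ kᵢ kⱼ aᵢ aⱼ aᵢⱼ →
          k :* (k :* con 1ℚ) :* con 0ℚ
            :- (k :* (k :* con 1ℚ) :* aᵢⱼ :+ k :* kᵢ :* (:- aⱼ) :+ k :* kⱼ :* (:- aᵢ)
                :+ kᶠ :* (:- aᵢ) :* (:- aⱼ))
          := :- (k :* (k :* con 1ℚ) :* aᵢⱼ :- k :* (kᵢ :* aⱼ :+ kⱼ :* aᵢ) :+ kᶠ :* aᵢ :* aⱼ)) refl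
        (⟦ κ ⟧ ρ) (⟦ κᶠ ⟧ ρ) (⟦ κᵢ ⟧ ρ) (⟦ κⱼ ⟧ ρ) (⟦ aᵢ ⟧ ρ) (⟦ aⱼ ⟧ ρ) (⟦ aᵢⱼ ⟧ ρ)) ⟩
  neg (κ ^^ 2 ⊗ aᵢⱼ ⊖ κ ⊗ (κᵢ ⊗ aⱼ ⊕ κⱼ ⊗ aᵢ) ⊕ κᶠ ⊗ aᵢ ⊗ aⱼ)
    ∎
  where open SetoidReasoning ≋-setoid

-- Superscripts denote partial derivatives of P and of K = Pᶠ, viewed as
-- polynomials in independent t, x, F. Nᵢⱼ is the numerator of implicit
-- differentiation: K³ F_ij = -Nᵢⱼ for the algebraic function F cut out by P = 0.
Pᵗ Pˣ Pᵗᵗ Pᵗˣ Pˣˣ Kᵗ Kˣ Kᶠ : Expr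
Pᵗ  = # 1 ⊕ # 2 ⊗ vt ⊗ vx ⊖ vF ⊕ # 2 ⊗ vx ^^ 2 ⊗ vF ^^ 2
Pˣ  = vt ^^ 2 ⊕ # 4 ⊗ vt ⊗ vx ⊗ vF ^^ 2 ⊕ # 3 ⊗ vx ^^ 2 ⊗ vF ^^ 4
Pᵗᵗ = # 2 ⊗ vx
Pᵗˣ = # 2 ⊗ vt ⊕ # 4 ⊗ vx ⊗ vF ^^ 2
Pˣˣ = # 4 ⊗ vt ⊗ vF ^^ 2 ⊕ # 6 ⊗ vx ⊗ vF ^^ 4
Kᵗ  = neg (# 1) ⊕ # 4 ⊗ vx ^^ 2 ⊗ vF
Kˣ  = # 8 ⊗ vt ⊗ vx ⊗ vF ⊕ # 12 ⊗ vx ^^ 2 ⊗ vF ^^ 3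
Kᶠ  = # 4 ⊗ vt ⊗ vx ^^ 2 ⊕ # 12 ⊗ vx ^^ 3 ⊗ vF ^^ 2

Nₜₜ Nₜₓ Nₓₓ : Expr
Nₜₜ = K ^^ 2 ⊗ Pᵗᵗ ⊖ K ⊗ (Kᵗ ⊗ Pᵗ ⊕ Kᵗ ⊗ Pᵗ) ⊕ Kᶠ ⊗ Pᵗ ⊗ Pᵗ
Nₜₓ = K ^^ 2 ⊗ Pᵗˣ ⊖ K ⊗ (Kᵗ ⊗ Pˣ ⊕ Kˣ ⊗ Pᵗ) ⊕ Kᶠ ⊗ Pᵗ ⊗ Pˣ
Nₓₓ = K ^^ 2 ⊗ Pˣˣ ⊖ K ⊗ (Kˣ ⊗ Pˣ ⊕ Kˣ ⊗ Pˣ) ⊕ Kᶠ ⊗ Pˣ ⊗ Pˣ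

K⊗Ft≋negPᵗ : K ⊗ vFt ≋ neg Pᵗ
K⊗Ft≋negPᵗ = implicitFirstDerivative (≋-byNormalisation tt) (∈𝓘⇒≋0 Pt∈𝓘)

K⊗Fx≋negPˣ : K ⊗ vFx ≋ neg Pˣ
K⊗Fx≋negPˣ = implicitFirstDerivative (≋-byNormalisation tt) (∈𝓘⇒≋0 Px∈𝓘)

K³⊗Ftt≋negNₜₜ : K ^^ 3 ⊗ vFtt ≋ neg Nₜₜ
K³⊗Ftt≋negNₜₜ = implicitSecondDerivative K⊗Ft≋negPᵗ K⊗Ft≋negPᵗ
  (≋-trans (≋-byNormalisation tt) (∈𝓘⇒≋0 Ptt∈𝓘))

K³⊗Ftx≋negNₜₓ : K ^^ 3 ⊗ vFtx ≋ neg Nₜₓ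
K³⊗Ftx≋negNₜₓ = implicitSecondDerivative K⊗Ft≋negPᵗ K⊗Fx≋negPˣ
  (≋-trans (≋-byNormalisation tt) (∈𝓘⇒≋0 Ptx∈𝓘))

K³⊗Fxx≋negNₓₓ : K ^^ 3 ⊗ vFxx ≋ neg Nₓₓ
K³⊗Fxx≋negNₓₓ = implicitSecondDerivative K⊗Fx≋negPˣ K⊗Fx≋negPˣ
  (≋-trans (≋-byNormalisation tt) (∈𝓘⇒≋0 Pxx∈𝓘))

record SecondOrderOperator : Set where
  field c₀ cₜ cₓ cₜₜ cₜₓ cₓₓ : Expr

open SecondOrderOperator

infix 9 _[F]
_[F] : SecondOrderOperator → Expr
L [F] = c₀ L ⊗ vF ⊕ cₜ L ⊗ vFt ⊕ cₓ L ⊗ vFx ⊕ cₜₜ L ⊗ vFtt ⊕ cₜₓ L ⊗ vFtx ⊕ cₓₓ L ⊗ vFxx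

reduced : SecondOrderOperator → Expr
reduced L = K ^^ 3 ⊗ c₀ L ⊗ vF ⊕ K ^^ 2 ⊗ cₜ L ⊗ neg Pᵗ ⊕ K ^^ 2 ⊗ cₓ L ⊗ neg Pˣ
          ⊕ cₜₜ L ⊗ neg Nₜₜ ⊕ cₜₓ L ⊗ neg Nₜₓ ⊕ cₓₓ L ⊗ neg Nₓₓ

K³⊗[F]≋reduced : ∀ L → K ^^ 3 ⊗ L [F] ≋ reduced L
K³⊗[F]≋reduced L = begin
  K ^^ 3 ⊗ L [F]
    ≈⟨ ≈⇒≋ (λ ρ → solve 13 (λ k c₀ cₜ cₓ cₜₜ cₜₓ cₓₓ f fₜ fₓ fₜₜ fₜₓ fₓₓ →
          k :* (k :* (k :* con 1ℚ))
            :* (c₀ :* f :+ cₜ :* fₜ :+ cₓ :* fₓ :+ cₜₜ :* fₜₜ :+ cₜₓ :* fₜₓ :+ cₓₓ :* fₓₓ)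
          := k :* (k :* (k :* con 1ℚ)) :* c₀ :* f :+ k :* (k :* con 1ℚ) :* cₜ :* (k :* fₜ)
             :+ k :* (k :* con 1ℚ) :* cₓ :* (k :* fₓ) :+ cₜₜ :* (k :* (k :* (k :* con 1ℚ)) :* fₜₜ)
             :+ cₜₓ :* (k :* (k :* (k :* con 1ℚ)) :* fₜₓ)
             :+ cₓₓ :* (k :* (k :* (k :* con 1ℚ)) :* fₓₓ)) refl
        (⟦ K ⟧ ρ) (⟦ c₀ L ⟧ ρ) (⟦ cₜ L ⟧ ρ) (⟦ cₓ L ⟧ ρ) (⟦ cₜₜ L ⟧ ρ) (⟦ cₜₓ L ⟧ ρ) (⟦ cₓₓ L ⟧ ρ)
        (⟦ vF ⟧ ρ) (⟦ vFt ⟧ ρ) (⟦ vFx ⟧ ρ) (⟦ vFtt ⟧ ρ) (⟦ vFtx ⟧ ρ) (⟦ vFxx ⟧ ρ)) ⟩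
  K ^^ 3 ⊗ c₀ L ⊗ vF ⊕ K ^^ 2 ⊗ cₜ L ⊗ (K ⊗ vFt) ⊕ K ^^ 2 ⊗ cₓ L ⊗ (K ⊗ vFx)
    ⊕ cₜₜ L ⊗ (K ^^ 3 ⊗ vFtt) ⊕ cₜₓ L ⊗ (K ^^ 3 ⊗ vFtx) ⊕ cₓₓ L ⊗ (K ^^ 3 ⊗ vFxx)
    ≈⟨ ⊕-cong (⊕-cong (⊕-cong (⊕-cong (⊕-cong ≋-refl
                                                (⊗-cong ≋-refl K⊗Ft≋negPᵗ))
                                        (⊗-cong ≋-refl K⊗Fx≋negPˣ))
                                (⊗-cong ≋-refl K³⊗Ftt≋negNₜₜ))
                        (⊗-cong ≋-refl K³⊗Ftx≋negNₜₓ))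
                (⊗-cong ≋-refl K³⊗Fxx≋negNₓₓ) ⟩
  reduced L
    ∎
  where open SetoidReasoning ≋-setoid

K³⊗-InI-byReduction : ∀ e L R → e ≋ L [F] → reduced L ≋ R ⊗ P → InI (K ^^ 3 ⊗ e)
K³⊗-InI-byReduction e L R e≋L[F] reduced≋R⊗P = certificate (≋0⇒∈𝓘 (begin
  K ^^ 3 ⊗ e      ≈⟨ ⊗-cong ≋-refl e≋L[F] ⟩
  K ^^ 3 ⊗ L [F]  ≈⟨ K³⊗[F]≋reduced L ⟩
  reduced L       ≈⟨ reduced≋R⊗P ⟩
  R ⊗ P           ≈⟨ ⊗-cong ≋-refl (∈𝓘⇒≋0 P∈𝓘) ⟩
  R ⊗ # 0         ≈⟨ ≈⇒≋ (λ ρ → solve 1 (λ r → r :* con 0ℚ := con 0ℚ) refl (⟦ R ⟧ ρ)) ⟩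
  # 0             ∎))
  where open SetoidReasoning ≋-setoid

Q-operator Q̃-operator : SecondOrderOperator
Q-operator = record
  { c₀  = # 8 ⊗ vt ⊗ vx
  ; cₜ  = neg (# 16 ⊗ vt ^^ 2 ⊗ vx) ⊖ # 3 ⊗ vt
  ; cₓ  = # 16 ⊗ vt ⊗ vx ^^ 2 ⊕ vx
  ; cₜₜ = neg (# 12 ⊗ vt ^^ 3 ⊗ vx) ⊖ # 9 ⊗ vt ^^ 2
  ; cₜₓ = neg (# 8 ⊗ vt ^^ 2 ⊗ vx ^^ 2) ⊖ # 6 ⊗ vt ⊗ vx
  ; cₓₓ = # 4 ⊗ vt ⊗ vx ^^ 3 ⊖ vx ^^ 2
  }
Q̃-operator = record
  { c₀  = # 0
  ; cₜ  = neg (# 3 ⊗ vt ^^ 2)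
  ; cₓ  = # 8 ⊗ vx ^^ 2 ⊖ # 3 ⊗ vt ⊗ vx
  ; cₜₜ = neg (# 12 ⊗ vt ^^ 2 ⊗ vx) ⊖ # 9 ⊗ vt ^^ 3
  ; cₜₓ = # 8 ⊗ vt ⊗ vx ^^ 2 ⊕ # 6 ⊗ vt ^^ 2 ⊗ vx
  ; cₓₓ = # 4 ⊗ vx ^^ 3 ⊖ vt ⊗ vx ^^ 2
  }

-- Quotients of the divisions of reduced Q-operator and reduced Q̃-operator by P
-- in ℚ(t,x)[F]; both remainders vanish.
Q-cofactor Q̃-cofactor : Expr
Q-cofactor =
  neg (# 15 ⊗ vt ^^ 2)
    ⊕ # 36 ⊗ vt ^^ 2 ⊗ vx ^^ 2
    ⊕ # 180 ⊗ vt ^^ 3 ⊗ vx ^^ 3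
    ⊕ # 240 ⊗ vt ^^ 4 ⊗ vx ^^ 4
    ⊕ # 132 ⊗ vt ^^ 2 ⊗ vx ^^ 2 ⊗ vF
    ⊕ # 80 ⊗ vt ^^ 3 ⊗ vx ^^ 3 ⊗ vF
    ⊕ # 108 ⊗ vt ⊗ vx ^^ 3 ⊗ vF ^^ 2
    ⊕ # 276 ⊗ vt ^^ 2 ⊗ vx ^^ 4 ⊗ vF ^^ 2
    ⊕ # 560 ⊗ vt ^^ 3 ⊗ vx ^^ 5 ⊗ vF ^^ 2
    ⊕ # 12 ⊗ vt ⊗ vx ^^ 3 ⊗ vF ^^ 3
    ⊖ # 80 ⊗ vt ^^ 2 ⊗ vx ^^ 4 ⊗ vF ^^ 3
    ⊖ # 132 ⊗ vt ⊗ vx ^^ 5 ⊗ vF ^^ 4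
    ⊕ # 400 ⊗ vt ^^ 2 ⊗ vx ^^ 6 ⊗ vF ^^ 4
    ⊖ # 132 ⊗ vx ^^ 6 ⊗ vF ^^ 6
    ⊕ # 80 ⊗ vt ⊗ vx ^^ 7 ⊗ vF ^^ 6
Q̃-cofactor =
  neg (# 24 ⊗ vt ^^ 2 ⊗ vx)
    ⊕ # 48 ⊗ vt ^^ 2 ⊗ vx ^^ 3
    ⊖ # 15 ⊗ vt ^^ 3
    ⊕ # 20 ⊗ vt ^^ 3 ⊗ vx ^^ 2
    ⊕ # 112 ⊗ vt ^^ 3 ⊗ vx ^^ 4
    ⊕ # 100 ⊗ vt ^^ 4 ⊗ vx ^^ 3
    ⊕ # 80 ⊗ vt ^^ 2 ⊗ vx ^^ 3 ⊗ vF
    ⊕ # 20 ⊗ vt ^^ 3 ⊗ vx ^^ 2 ⊗ vF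
    ⊕ # 144 ⊗ vt ⊗ vx ^^ 4 ⊗ vF ^^ 2
    ⊕ # 60 ⊗ vt ^^ 2 ⊗ vx ^^ 3 ⊗ vF ^^ 2
    ⊕ # 176 ⊗ vt ^^ 2 ⊗ vx ^^ 5 ⊗ vF ^^ 2
    ⊕ # 260 ⊗ vt ^^ 3 ⊗ vx ^^ 4 ⊗ vF ^^ 2
    ⊖ # 144 ⊗ vt ⊗ vx ^^ 4 ⊗ vF ^^ 3
    ⊖ # 180 ⊗ vt ^^ 2 ⊗ vx ^^ 3 ⊗ vF ^^ 3
    ⊕ # 16 ⊗ vt ⊗ vx ^^ 6 ⊗ vF ^^ 4
    ⊕ # 220 ⊗ vt ^^ 2 ⊗ vx ^^ 5 ⊗ vF ^^ 4
    ⊖ # 48 ⊗ vx ^^ 7 ⊗ vF ^^ 6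
    ⊕ # 60 ⊗ vt ⊗ vx ^^ 6 ⊗ vF ^^ 6

lemma5p4 : InI (K ^^ 3 ⊗ Q) × InI (K ^^ 3 ⊗ Q̃)
lemma5p4 =
  K³⊗-InI-byReduction Q Q-operator Q-cofactor (≋-byNormalisation tt) (≋-byNormalisation tt) ,
  K³⊗-InI-byReduction Q̃ Q̃-operator Q̃-cofactor (≋-byNormalisation tt) (≋-byNormalisation tt)
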